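{- Fix $n\ge 3$. Let $\Sigma_n$ be an alphabet with $n$ letters and $\Sigma_2=\{0,1\}$. Suppose $f:\Sigma_n^*\to\Sigma_2^*$ is a morphism satisfying: (1) for every square-free word $v\in\Sigma_n^3$ (of length 3), $f(v)$ is an FS word; (2) there is a word $p\in\Sigma_2^*$ with $|p|\ge 3$ such that (a) for each $a\in\Sigma_n$, $p$ is a prefix of $f(a)$, and (b) whenever $a_1,\dots,a_\ell\in\Sigma_n$ and $f(a_1a_2\cdots a_\ell)=qpr$ for some words $q,r\in\Sigma_2^*$, then $q=\epsilon$ or $q=f(a_1a_2\cdots a_j)$ for some $j\le \ell$. Then $f$ is an FS morphism, i.e. $f(w)$ is an FS word for every square-free word $w\in\Sigma_n^*$.
   Context: A square is a nonempty word of the form $uu$; a word is square-free if it has no square factor. An FS word is a word over $\{0,1\}$ containing no square factors other than $00$, $11$, and $0101$. A morphism is a monoid homomorphism between free monoids; $\epsilon$ denotes the empty word. A morphism $f:\Sigma^*\to\{0,1\}^*$ is an FS morphism if $f(w)$ is an FS word whenever $w$ is square-free. -}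

module Defs where

open import Data.Nat using (ℕ; _≤_)
open import Data.Fin using (Fin; zero; suc)
open import Data.List using (List; []; _∷_; _++_; concatMap; length; take)
open import Data.Product using (Σ; ∃; _×_; _,_)
open import Data.Sum using (_⊎_)
open import Relation.Binary.PropositionalEquality using (_≡_; _≢_)
open import Relation.Nullary using (¬_)

Σ₂ : Set
Σ₂ = Fin 2

𝟎 𝟏 : Σ₂
𝟎 = zero
𝟏 = suc zero

Factor : {A : Set} → List A → List A → Set
Factor {A} u w = Σ (List A) λ x → Σ (List A) λ y → w ≡ x ++ u ++ y

SquareFree : {A : Set} → List A → Set
SquareFree {A} w = (u : List A) → u ≢ [] → ¬ Factor (u ++ u) w

AllowedSquare : List Σ₂ → Set
AllowedSquare s = (s ≡ 𝟎 ∷ 𝟎 ∷ []) ⊎ ((s ≡ 𝟏 ∷ 𝟏 ∷ []) ⊎ (s ≡ 𝟎 ∷ 𝟏 ∷ 𝟎 ∷ 𝟏 ∷ []))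

FS : List Σ₂ → Set
FS w = (u : List Σ₂) → u ≢ [] → Factor (u ++ u) w → AllowedSquare (u ++ u)

morph : {n : ℕ} → (Fin n → List Σ₂) → List (Fin n) → List Σ₂
morph h = concatMap h

Prefix : {A : Set} → List A → List A → Set
Prefix {A} p w = Σ (List A) λ r → w ≡ p ++ r

FSMorphism : {n : ℕ} → (Fin n → List Σ₂) → Set
FSMorphism {n} h = (w : List (Fin n)) → SquareFree w → FS (morph h w)

module Submission where

open import Defs
open import Data.Nat using (ℕ; _≤_; _≥_; _+_; suc; z≤n; s≤s)
open import Data.Nat.Properties using (≤-trans; ≤-reflexive; +-mono-≤; +-monoʳ-≤; m+n≤o⇒n≤o; n≤1+n)
open import Data.Fin as Fin using (Fin)
open import Data.Fin.Properties using (_≟_)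
open import Data.List using (List; []; _∷_; _++_; [_]; _∷ʳ_; length; take; drop; initLast; _∷ʳ′_)
open import Data.List.Properties
  using (++-monoid; ++-assoc; ++-identityʳ; ++-identityʳ-unique; ++-cancelˡ; ++-conicalˡ; ++-conicalʳ;
         ∷-injectiveˡ; ∷-injectiveʳ; length-++; length-++-≤ˡ; length-++-≤ʳ; length-++-comm;
         take++drop≡id; concatMap-++)
open import Data.Product using (Σ; ∃; ∃₂; _×_; _,_; proj₁; proj₂)
open import Data.Sum using (_⊎_; inj₁; inj₂)
open import Data.Empty using (⊥; ⊥-elim)
open import Function using (_∘_; case_of_)
open import Relation.Nullary using (¬_; Dec; yes; no)
open import Relation.Binary.PropositionalEquality
  using (_≡_; _≢_; refl; sym; trans; cong; cong₂; subst; ≢-sym; module ≡-Reasoning)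
open import Tactic.MonoidSolver using (solve)

-- Condition (2b) makes every occurrence of p in an image f(w) start at a letter boundary,
-- so no letter image is a proper suffix of another, and by (1) none is a prefix of another;
-- hence f is injective.  Let uu be a square in f(w) with w square-free.
-- If p occurs in u, synchronizing at the two matching occurrences of p in uu pulls the square
-- back to a square in w; the only obstruction is an overhanging piece B of a letter image a
-- before the first occurrence, and chasing it produces letters a, c, e with f(ace) containing
-- a square of length 2|f(c)| ≥ 6, against (1).  If p does not occur in u, then since every
-- letter image begins with p, uu meets at most three consecutive letter images, so uu is a
-- factor of f(v) for a square-free v of length 3, and (1) applies.

module _ {A : Set} where

  ++-equidivisible : ∀ (xs ys zs ws : List A) → xs ++ ys ≡ zs ++ ws →
    (∃ λ m → xs ≡ zs ++ m × ws ≡ m ++ ys) ⊎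
    (∃ λ m → m ≢ [] × zs ≡ xs ++ m × ys ≡ m ++ ws)
  ++-equidivisible xs       ys []       ws eq = inj₁ (xs , refl , sym eq)
  ++-equidivisible []       ys (z ∷ zs) ws eq = inj₂ (z ∷ zs , (λ ()) , refl , eq)
  ++-equidivisible (x ∷ xs) ys (z ∷ zs) ws eq
    with ∷-injectiveˡ eq | ++-equidivisible xs ys zs ws (∷-injectiveʳ eq)
  ... | refl | inj₁ (m , xs≡ , ws≡)      = inj₁ (m , cong (x ∷_) xs≡ , ws≡)
  ... | refl | inj₂ (m , m≢[] , zs≡ , ys≡) = inj₂ (m , m≢[] , cong (x ∷_) zs≡ , ys≡)

  ++-≢[]ʳ : ∀ xs {ys : List A} → ys ≢ [] → xs ++ ys ≢ []
  ++-≢[]ʳ xs ys≢[] = ys≢[] ∘ ++-conicalʳ xs _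

  Factor-++ʳ : ∀ {u w : List A} t → Factor u w → Factor u (w ++ t)
  Factor-++ʳ t (l , r , refl) = l , r ++ t , solve (++-monoid A)

  length-factor : ∀ (x u y : List A) → length x + length u ≤ length (x ++ u ++ y)
  length-factor x u y =
    ≤-trans (+-monoʳ-≤ (length x) (length-++-≤ˡ u)) (≤-reflexive (sym (length-++ x)))

  factor-or-suffix : ∀ {s q t u : List A} → u ++ u ≡ s ++ q ++ t →
    Factor q u ⊎ ∃ λ K → u ≡ K ++ t
  factor-or-suffix {s} {q} {t} {u} eq with ++-equidivisible u u s (q ++ t) eq
  ... | inj₂ (m , _ , _ , u≡) = inj₁ (m , t , u≡)
  ... | inj₁ (γ , u≡sγ , qt≡γu) with ++-equidivisible q t γ u qt≡γu
  ...   | inj₁ (K , _ , u≡Kt)        = inj₂ (K , u≡Kt)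
  ...   | inj₂ (m , _ , γ≡qm , _)      = inj₁ (s , m , trans u≡sγ (cong (s ++_) γ≡qm))

  adjacent-distinct : ∀ {w : List A} l {a b} r → SquareFree w → w ≡ l ++ a ∷ b ∷ r → a ≢ b
  adjacent-distinct l r sf w≡ refl = sf [ _ ] (λ ()) (l , r , w≡)

  square-free-three : ∀ {a b c : A} → a ≢ b → b ≢ c → SquareFree (a ∷ b ∷ c ∷ [])
  square-free-three a≢b b≢c []               []≢[] _                   = []≢[] refl
  square-free-three a≢b b≢c (_ ∷ [])         _     ([] , _ , refl)     = a≢b refl
  square-free-three a≢b b≢c (_ ∷ [])         _     (_ ∷ [] , _ , refl) = b≢c refl
  square-free-three a≢b b≢c u@(_ ∷ [])       _     (x@(_ ∷ _ ∷ x′) , y , eq)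
    with subst (λ w → length x + 2 ≤ length w) (sym eq) (length-factor x (u ++ u) y)
  ... | s≤s (s≤s le) with m+n≤o⇒n≤o (length x′) le
  ...   | s≤s ()
  square-free-three a≢b b≢c u@(_ ∷ _ ∷ u′) _ (x , y , eq)
    with m+n≤o⇒n≤o (length x)
           (subst (λ w → length x + length (u ++ u) ≤ length w) (sym eq) (length-factor x (u ++ u) y))
  ... | s≤s (s≤s le) with ≤-trans (length-++-≤ʳ u {u′}) le
  ...   | s≤s ()

distinct-letter : ∀ {k} → 2 ≤ k → (a : Fin k) → ∃ λ b → b ≢ a
distinct-letter (s≤s (s≤s _)) Fin.zero    = Fin.suc Fin.zero , λ ()
distinct-letter (s≤s (s≤s _)) (Fin.suc _) = Fin.zero , λ ()

AllowedSquare-length : ∀ {s} → AllowedSquare s → length s ≤ 4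
AllowedSquare-length (inj₁ refl)        = s≤s (s≤s z≤n)
AllowedSquare-length (inj₂ (inj₁ refl)) = s≤s (s≤s z≤n)
AllowedSquare-length (inj₂ (inj₂ refl)) = s≤s (s≤s (s≤s (s≤s z≤n)))

FS-short-squares : ∀ {s} x → FS s → 3 ≤ length x → ¬ Factor (x ++ x) s
FS-short-squares x fs 3≤|x| xx⊑s =
  case ≤-trans (+-mono-≤ 3≤|x| 3≤|x|) |xx|≤4 of λ { (s≤s (s≤s (s≤s (s≤s ())))) }
  where
  x≢[] : x ≢ []
  x≢[] refl = case 3≤|x| of λ ()

  |xx|≤4 : length x + length x ≤ 4
  |xx|≤4 = ≤-trans (≤-reflexive (sym (length-++ x))) (AllowedSquare-length (fs x x≢[] xx⊑s))

module Synchronizing {n : ℕ} (h : Fin n → List Σ₂)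
  (fs-triples : (v : List (Fin n)) → length v ≡ 3 → SquareFree v → FS (morph h v))
  (p : List Σ₂) (p-long : length p ≥ 3)
  (p-prefix : (a : Fin n) → Prefix p (h a))
  (sync : (as : List (Fin n)) (q r : List Σ₂) → morph h as ≡ q ++ p ++ r
          → (q ≡ []) ⊎ ∃ λ j → j ≤ length as × q ≡ morph h (take j as))
  (distinct : (a : Fin n) → ∃ λ b → b ≢ a) where

  f : List (Fin n) → List Σ₂
  f = morph h

  f-++ : ∀ xs ys → f (xs ++ ys) ≡ f xs ++ f ys
  f-++ = concatMap-++ h

  f-∷ʳ : ∀ v c → f (v ∷ʳ c) ≡ f v ++ h c
  f-∷ʳ v c = trans (f-++ v [ c ]) (cong (f v ++_) (++-identityʳ (h c)))

  rest : Fin n → List Σ₂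
  rest a = proj₁ (p-prefix a)

  f-∷ : ∀ a w → f (a ∷ w) ≡ p ++ rest a ++ f w
  f-∷ a w = trans (cong (_++ f w) (proj₂ (p-prefix a))) (++-assoc p (rest a) (f w))

  p≢[] : p ≢ []
  p≢[] refl = case p-long of λ ()

  h≢[] : ∀ a → h a ≢ []
  h≢[] a eq = p≢[] (++-conicalˡ p (rest a) (trans (sym (proj₂ (p-prefix a))) eq))

  |h|≥3 : ∀ a → 3 ≤ length (h a)
  |h|≥3 a = ≤-trans p-long
    (≤-trans (length-++-≤ˡ p) (≤-reflexive (cong length (sym (proj₂ (p-prefix a))))))

  f≡[]⇒≡[] : ∀ w → f w ≡ [] → w ≡ []
  f≡[]⇒≡[] []      _  = refl
  f≡[]⇒≡[] (a ∷ w) eq = ⊥-elim (h≢[] a (++-conicalˡ (h a) (f w) eq))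

  p-prefixed⇒≢[] : ∀ w {X} → f w ≡ p ++ X → w ≢ []
  p-prefixed⇒≢[] w eq refl = p≢[] (++-conicalˡ p _ (sym eq))

  synchronize : ∀ w q r → f w ≡ q ++ p ++ r →
    ∃₂ λ w₁ w₂ → w ≡ w₁ ++ w₂ × f w₁ ≡ q × f w₂ ≡ p ++ r
  synchronize w q r eq with sync w q r eq
  ... | inj₁ refl         = [] , w , refl , refl , eq
  ... | inj₂ (j , _ , q≡) =
    take j w , drop j w , sym (take++drop≡id j w) , sym q≡ , ++-cancelˡ q _ _ (begin
      q ++ f (drop j w)              ≡⟨ cong (_++ f (drop j w)) q≡ ⟩
      f (take j w) ++ f (drop j w)   ≡⟨ f-++ (take j w) (drop j w) ⟨
      f (take j w ++ drop j w)       ≡⟨ cong f (take++drop≡id j w) ⟩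
      f w                            ≡⟨ eq ⟩
      q ++ p ++ r                    ∎)
    where open ≡-Reasoning

  p-at-start : ∀ a q r → h a ≡ q ++ p ++ r → q ≡ []
  p-at-start a q r eq with sync [ a ] q r (trans (++-identityʳ (h a)) eq)
  ... | inj₁ q≡[]                  = q≡[]
  ... | inj₂ (0 , _ , q≡[])        = q≡[]
  ... | inj₂ (1 , _ , q≡ha)        = ⊥-elim (p≢[] (++-conicalˡ p r (++-identityʳ-unique (h a)
          (trans eq (cong (_++ p ++ r) (trans q≡ha (++-identityʳ (h a))))))))
  ... | inj₂ (suc (suc _) , s≤s () , _)

  image-not-proper-suffix : ∀ a c {α} → α ≢ [] → h a ≢ α ++ h c
  image-not-proper-suffix a c α≢[] eq =
    α≢[] (p-at-start a _ (rest c) (trans eq (cong (_ ++_) (proj₂ (p-prefix c)))))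

  image-not-prefix : ∀ {a b} m → a ≢ b → h b ≢ h a ++ m
  image-not-prefix {a} {b} m a≢b hb≡ with distinct b
  ... | c , c≢b = FS-short-squares (h a)
    (fs-triples (a ∷ b ∷ c ∷ []) refl (square-free-three a≢b (≢-sym c≢b))) (|h|≥3 a)
    ([] , m ++ h c ++ [] , trans (cong (λ t → h a ++ t ++ h c ++ []) hb≡) (solve (++-monoid Σ₂)))

  image-not-proper-prefix : ∀ c e {m} → m ≢ [] → h c ≢ h e ++ m
  image-not-proper-prefix c e m≢[] hc≡ with e ≟ c
  ... | yes refl = m≢[] (++-identityʳ-unique (h e) hc≡)
  ... | no e≢c   = image-not-prefix _ e≢c hc≡

  f-cancelˡ : ∀ r v {z} → f r ≡ f v ++ z → ∃ λ r′ → r ≡ v ++ r′ × f r′ ≡ z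
  f-cancelˡ r       []      eq = r , refl , eq
  f-cancelˡ []      (b ∷ v) {z} eq =
    ⊥-elim (h≢[] b (++-conicalˡ (h b) _ (sym (trans eq (++-assoc (h b) (f v) z)))))
  f-cancelˡ (d ∷ r) (b ∷ v) {z} eq with d ≟ b
  ... | yes refl with f-cancelˡ r v (++-cancelˡ (h d) _ _ (trans eq (++-assoc (h d) (f v) z)))
  ...   | r′ , refl , fr′ = r′ , refl , fr′
  f-cancelˡ (d ∷ r) (b ∷ v) {z} eq | no d≢b
    with ++-equidivisible (h d) (f r) (h b) (f v ++ z) (trans eq (++-assoc (h b) (f v) z))
  ... | inj₁ (m , hd≡ , _)      = ⊥-elim (image-not-prefix m (≢-sym d≢b) hd≡)
  ... | inj₂ (m , _ , hb≡ , _) = ⊥-elim (image-not-prefix m d≢b hb≡)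

  f-injective : ∀ r v → f r ≡ f v → r ≡ v
  f-injective r v eq with f-cancelˡ r v (trans eq (sym (++-identityʳ (f v))))
  ... | r′ , refl , fr′≡[] rewrite f≡[]⇒≡[] r′ fr′≡[] = ++-identityʳ v

  f-cancelʳ : ∀ r X v → f r ≡ X ++ f v → ∃ λ r′ → r ≡ r′ ++ v × f r′ ≡ X
  f-cancelʳ r X []      eq = r , sym (++-identityʳ r) , trans eq (++-identityʳ X)
  f-cancelʳ r X (d ∷ v) eq
    with synchronize r X (rest d ++ f v) (trans eq (cong (X ++_) (f-∷ d v)))
  ... | r₁ , r₂ , refl , fr₁ , fr₂ =
    r₁ , cong (r₁ ++_) (f-injective r₂ (d ∷ v) (trans fr₂ (sym (f-∷ d v)))) , fr₁

  record Cut (w : List (Fin n)) (γ : List Σ₂) : Set where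
    constructor cut-at
    field
      before : List (Fin n)
      letter : Fin n
      after  : List (Fin n)
      head tail : List Σ₂
      split-w      : w ≡ before ++ letter ∷ after
      split-letter : h letter ≡ head ++ tail
      tail≢[]      : tail ≢ []
      split-γ      : γ ≡ tail ++ f after

  cut : ∀ w α γ → γ ≢ [] → f w ≡ α ++ γ → Cut w γ
  cut []      α γ γ≢[] eq = ⊥-elim (γ≢[] (++-conicalʳ α γ (sym eq)))
  cut (b ∷ w) α γ γ≢[] eq with ++-equidivisible α γ (h b) (f w) (sym eq)
  ... | inj₂ (m , m≢[] , hb≡ , γ≡) = cut-at [] b w α m refl hb≡ m≢[] γ≡
  ... | inj₁ (m , _ , fw≡) with cut w m γ γ≢[] fw≡
  ...   | cut-at w₁ a w₂ α₁ α₂ refl ha≡ α₂≢[] γ≡ =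
    cut-at (b ∷ w₁) a w₂ α₁ α₂ refl ha≡ α₂≢[] γ≡

  record SuffixParse (w : List (Fin n)) (y : List Σ₂) : Set where
    constructor parsed
    field
      front back : List (Fin n)
      overhang   : List Σ₂
      split-w    : w ≡ front ++ back
      split-y    : y ≡ overhang ++ f back
      proper     : overhang ≡ [] ⊎
                   ∃₂ λ w₀ a → front ≡ w₀ ∷ʳ a × ∃ λ α → α ≢ [] × h a ≡ α ++ overhang

  suffix-parse : ∀ w α y → f w ≡ α ++ y → SuffixParse w y
  suffix-parse []      α y eq = parsed [] [] [] refl (++-conicalʳ α y (sym eq)) (inj₁ refl)
  suffix-parse (b ∷ w) α y eq with ++-equidivisible (h b) (f w) α y eq
  suffix-parse (b ∷ w) []      y eq | inj₁ (_ , refl , y≡) =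
    parsed [] (b ∷ w) [] refl y≡ (inj₁ refl)
  suffix-parse (b ∷ w) (a ∷ α) y eq | inj₁ (m , hb≡ , y≡) =
    parsed [ b ] w m refl y≡ (inj₂ ([] , b , refl , a ∷ α , (λ ()) , hb≡))
  ... | inj₂ (m , _ , _ , fw≡) with suffix-parse w m y fw≡
  ...   | parsed front back B refl y≡ (inj₁ B≡[]) = parsed (b ∷ front) back B refl y≡ (inj₁ B≡[])
  ...   | parsed front back B refl y≡ (inj₂ (w₀ , a , refl , ha≡)) =
    parsed (b ∷ front) back B refl y≡ (inj₂ (b ∷ w₀ , a , refl , ha≡))

  aligned-repeat : ∀ w₁ x v w₄ {P β} → SquareFree (w₁ ++ x ++ v ++ x ++ w₄) →
    v ≢ [] → f v ≡ P → f w₄ ≡ P ++ β → ⊥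
  aligned-repeat w₁ x v w₄ sf v≢[] refl fw₄ with f-cancelˡ w₄ v fw₄
  ... | w₇ , refl , _ = sf (x ++ v) (++-≢[]ʳ x v≢[]) (w₁ , w₇ , solve (++-monoid (Fin n)))

  overhanging-repeat : ∀ w₀ a x v w₄ {α₁ B P β} → SquareFree ((w₀ ∷ʳ a) ++ x ++ v ++ x ++ w₄) →
    α₁ ≢ [] → h a ≡ α₁ ++ B → v ≢ [] → f v ≡ P ++ B → f w₄ ≡ P ++ β → ⊥
  overhanging-repeat w₀ a x v w₄ {α₁} {B} {P} {β} sf α₁≢[] ha≡ v≢[] fv fw₄ with initLast v
  ... | []       = v≢[] refl
  ... | v′ ∷ʳ′ c with ++-equidivisible (f v′) (h c) P B (trans (sym (f-∷ʳ v′ c)) fv)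
  ...   | inj₁ (m , _ , B≡) = image-not-proper-suffix a c (α₁≢[] ∘ ++-conicalˡ α₁ m)
          (trans ha≡ (trans (cong (α₁ ++_) B≡) (sym (++-assoc α₁ m (h c)))))
  ...   | inj₂ (μ , μ≢[] , P≡ , hc≡)
    with f-cancelˡ w₄ v′ (trans fw₄ (trans (cong (_++ β) P≡) (++-assoc (f v′) μ β)))
  ...     | [] , _ , fw₈ = μ≢[] (++-conicalˡ μ β (sym fw₈))
  ...     | e ∷ w₈ , refl , fw₈ with ++-equidivisible (h e) (f w₈) μ β fw₈
  ...       | inj₂ (k , k≢[] , μ≡ , _) = image-not-proper-prefix c e (k≢[] ∘ ++-conicalˡ k B)
                (trans hc≡ (trans (cong (_++ B) μ≡) (++-assoc (h e) k B)))
  ...       | inj₁ (m , he≡ , _) = three-letters (a ≟ c) (c ≟ e)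
    where
    left-square : ∀ {L : Set} (l C x v t : List L) →
      (l ++ C) ++ x ++ (v ++ C) ++ x ++ v ++ t ≡ l ++ ((C ++ x ++ v) ++ (C ++ x ++ v)) ++ t
    left-square {L} l C x v t = solve (++-monoid L)

    right-square : ∀ {L : Set} (l C x v t : List L) →
      l ++ x ++ (v ++ C) ++ x ++ v ++ C ++ t ≡ l ++ ((x ++ v ++ C) ++ (x ++ v ++ C)) ++ t
    right-square {L} l C x v t = solve (++-monoid L)

    -- Now w = w₀ a x v′ c x v′ e w₈ and f(a c e) = α₁ B · μ B · μ m.
    three-letters : Dec (a ≡ c) → Dec (c ≡ e) → ⊥
    three-letters (yes refl) _ =
      sf (a ∷ x ++ v′) (λ ()) (w₀ , e ∷ w₈ , left-square w₀ [ a ] x v′ (e ∷ w₈))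
    three-letters (no _) (yes refl) =
      sf (x ++ v′ ∷ʳ c) (++-≢[]ʳ x (++-≢[]ʳ v′ λ ()))
         (w₀ ∷ʳ a , w₈ , right-square (w₀ ∷ʳ a) [ c ] x v′ w₈)
    three-letters (no a≢c) (no c≢e) =
      FS-short-squares (B ++ μ) (fs-triples (a ∷ c ∷ e ∷ []) refl (square-free-three a≢c c≢e))
        (≤-trans (|h|≥3 c) (≤-reflexive (trans (cong length hc≡) (length-++-comm μ B))))
        (α₁ , m ++ [] , trans (cong₂ _++_ ha≡ (cong₂ (λ s t → s ++ t ++ []) hc≡ he≡))
                              (solve (++-monoid Σ₂)))

  no-square-containing-p : ∀ w {α β u} → SquareFree w → f w ≡ α ++ (u ++ u) ++ β → ¬ Factor p u
  no-square-containing-p w {α} {β} sf eq (y , z , refl)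
    with synchronize w (α ++ y) (z ++ y ++ p ++ z ++ β) (trans eq (solve (++-monoid Σ₂)))
  ... | w₁ , w₂ , refl , fw₁ , fw₂
    with synchronize w₂ (p ++ z ++ y) (z ++ β) (trans fw₂ (solve (++-monoid Σ₂)))
  ... | w₃ , w₄ , refl , fw₃ , fw₄ with suffix-parse w₁ α y fw₁
  ... | parsed front x B refl refl proper
    with f-cancelʳ w₃ (p ++ z ++ B) x (trans fw₃ (solve (++-monoid Σ₂)))
  ... | v , refl , fv with proper
  ... | inj₁ refl = aligned-repeat front x v w₄ sf′ (p-prefixed⇒≢[] v fv)
                      (trans fv (cong (p ++_) (++-identityʳ z))) (trans fw₄ (sym (++-assoc p z β)))
    where
    reassoc : (front ++ x) ++ (v ++ x) ++ w₄ ≡ front ++ x ++ v ++ x ++ w₄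
    reassoc = solve (++-monoid (Fin n))
    sf′ : SquareFree (front ++ x ++ v ++ x ++ w₄)
    sf′ = subst SquareFree reassoc sf
  ... | inj₂ (w₀ , a , refl , α₁ , α₁≢[] , ha≡) =
    overhanging-repeat w₀ a x v w₄ sf′ α₁≢[] ha≡ (p-prefixed⇒≢[] v fv)
      (trans fv (sym (++-assoc p z B))) (trans fw₄ (sym (++-assoc p z β)))
    where
    reassoc : ((w₀ ∷ʳ a) ++ x) ++ (v ++ x) ++ w₄ ≡ (w₀ ∷ʳ a) ++ x ++ v ++ x ++ w₄
    reassoc = solve (++-monoid (Fin n))
    sf′ : SquareFree ((w₀ ∷ʳ a) ++ x ++ v ++ x ++ w₄)
    sf′ = subst SquareFree reassoc sf

  ShortFactor : List Σ₂ → Set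
  ShortFactor s = ∃ λ v → length v ≡ 3 × SquareFree v × Factor s (f v)

  short-triple : ∀ {a b c s} → a ≢ b → b ≢ c → Factor s (h a ++ h b ++ h c) → ShortFactor s
  short-triple {a} {b} {c} a≢b b≢c (l , r , eq) =
    a ∷ b ∷ c ∷ [] , refl , square-free-three a≢b b≢c ,
    l , r , trans (cong (λ t → h a ++ h b ++ t) (++-identityʳ (h c))) eq

  short-pair : ∀ {a b s} → a ≢ b → Factor s (h a ++ h b) → ShortFactor s
  short-pair {a} {b} a≢b s⊑ with distinct b
  ... | c , c≢b = short-triple a≢b (≢-sym c≢b)
                    (subst (Factor _) (++-assoc (h a) (h b) (h c)) (Factor-++ʳ (h c) s⊑))

  short-single : ∀ {a s} → Factor s (h a) → ShortFactor s
  short-single {a} s⊑ with distinct a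
  ... | b , b≢a = short-pair (≢-sym b≢a) (Factor-++ʳ (h b) s⊑)

  -- The p that begins f(b) lies in uu right after α₂; unless it lies in one half of uu,
  -- the rest δ′ of uu lies in the second half, so any later p would lie in u.
  square-beyond : ∀ w₁ a b w₃ {α₁ α₂ δ′ β u} → SquareFree (w₁ ++ a ∷ b ∷ w₃) →
    h a ≡ α₁ ++ α₂ → u ++ u ≡ α₂ ++ p ++ δ′ → rest b ++ f w₃ ≡ δ′ ++ β →
    Factor p u ⊎ ShortFactor (u ++ u)
  square-beyond w₁ a b [] {α₁} {α₂} {δ′} {β} {u} sf ha≡ uu≡ restb≡ =
    inj₂ (short-pair (adjacent-distinct w₁ [] sf refl) (α₁ , β , (begin
      h a ++ h b                  ≡⟨ cong₂ _++_ ha≡ (proj₂ (p-prefix b)) ⟩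
      (α₁ ++ α₂) ++ p ++ rest b   ≡⟨ cong (λ t → (α₁ ++ α₂) ++ p ++ t) restb≡′ ⟩
      (α₁ ++ α₂) ++ p ++ δ′ ++ β  ≡⟨ solve (++-monoid Σ₂) ⟩
      α₁ ++ (α₂ ++ p ++ δ′) ++ β  ≡⟨ cong (λ t → α₁ ++ t ++ β) uu≡ ⟨
      α₁ ++ (u ++ u) ++ β         ∎)))
    where
    open ≡-Reasoning
    restb≡′ : rest b ≡ δ′ ++ β
    restb≡′ = trans (sym (++-identityʳ (rest b))) restb≡
  square-beyond w₁ a b (c ∷ w₄) {α₁} {α₂} {δ′} {β} {u} sf ha≡ uu≡ restb≡
    with factor-or-suffix {s = α₂} {t = δ′} uu≡
  ... | inj₁ p⊑u = inj₁ p⊑u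
  ... | inj₂ (K , u≡)
    with ++-equidivisible δ′ β (rest b ++ p) (rest c ++ f w₄)
           (trans (sym restb≡) (trans (cong (rest b ++_) (f-∷ c w₄)) (solve (++-monoid Σ₂))))
  ...   | inj₁ (m , δ′≡ , _) =
    inj₁ (K ++ rest b , m , trans u≡ (trans (cong (K ++_) δ′≡) (solve (++-monoid Σ₂))))
  ...   | inj₂ (k , _ , bp≡ , _) =
    inj₂ (short-triple (adjacent-distinct w₁ (c ∷ w₄) sf refl)
                       (adjacent-distinct (w₁ ∷ʳ a) w₄ sf (sym (++-assoc w₁ [ a ] _)))
                       (α₁ , k ++ rest c , (begin
      h a ++ h b ++ h c                          ≡⟨ cong₂ _++_ ha≡ (cong₂ _++_ (proj₂ (p-prefix b))
                                                                               (proj₂ (p-prefix c))) ⟩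
      (α₁ ++ α₂) ++ (p ++ rest b) ++ p ++ rest c ≡⟨ solve (++-monoid Σ₂) ⟩
      α₁ ++ α₂ ++ p ++ (rest b ++ p) ++ rest c   ≡⟨ cong (λ t → α₁ ++ α₂ ++ p ++ t ++ rest c) bp≡ ⟩
      α₁ ++ α₂ ++ p ++ (δ′ ++ k) ++ rest c       ≡⟨ solve (++-monoid Σ₂) ⟩
      α₁ ++ (α₂ ++ p ++ δ′) ++ k ++ rest c       ≡⟨ cong (λ t → α₁ ++ t ++ k ++ rest c) uu≡ ⟨
      α₁ ++ (u ++ u) ++ k ++ rest c              ∎)))
    where open ≡-Reasoning

  square-across : ∀ w₁ a b w₃ {α₁ α₂ δ β u} → SquareFree (w₁ ++ a ∷ b ∷ w₃) →
    h a ≡ α₁ ++ α₂ → u ++ u ≡ α₂ ++ δ → f (b ∷ w₃) ≡ δ ++ β → Factor p u ⊎ ShortFactor (u ++ u)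
  square-across w₁ a b w₃ {α₁} {α₂} {δ} {β} {u} sf ha≡ uu≡ fbw₃≡
    with ++-equidivisible δ β p (rest b ++ f w₃) (trans (sym fbw₃≡) (f-∷ b w₃))
  ... | inj₂ (k , _ , p≡ , _) =
    inj₂ (short-pair (adjacent-distinct w₁ w₃ sf refl) (α₁ , k ++ rest b , (begin
      h a ++ h b                 ≡⟨ cong₂ _++_ ha≡ (proj₂ (p-prefix b)) ⟩
      (α₁ ++ α₂) ++ p ++ rest b  ≡⟨ cong (λ t → (α₁ ++ α₂) ++ t ++ rest b) p≡ ⟩
      (α₁ ++ α₂) ++ (δ ++ k) ++ rest b ≡⟨ solve (++-monoid Σ₂) ⟩
      α₁ ++ (α₂ ++ δ) ++ k ++ rest b   ≡⟨ cong (λ t → α₁ ++ t ++ k ++ rest b) uu≡ ⟨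
      α₁ ++ (u ++ u) ++ k ++ rest b    ∎)))
    where open ≡-Reasoning
  ... | inj₁ (δ′ , δ≡ , restb≡) =
    square-beyond w₁ a b w₃ {α₁} {α₂} {δ′} {β} {u} sf ha≡ (trans uu≡ (cong (α₂ ++_) δ≡)) restb≡

  square-short-or-contains-p : ∀ w {α β u} → SquareFree w → u ≢ [] → f w ≡ α ++ (u ++ u) ++ β →
    Factor p u ⊎ ShortFactor (u ++ u)
  square-short-or-contains-p w {α} {β} {u} sf u≢[] eq
    with cut w α ((u ++ u) ++ β) (u≢[] ∘ ++-conicalˡ u u ∘ ++-conicalˡ (u ++ u) β) eq
  ... | cut-at w₁ a w₂ α₁ α₂ refl ha≡ _ uuβ≡ with ++-equidivisible (u ++ u) β α₂ (f w₂) uuβ≡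
  ...   | inj₂ (m , _ , α₂≡ , _) = inj₂ (short-single (α₁ , m , trans ha≡ (cong (α₁ ++_) α₂≡)))
  ...   | inj₁ ([] , uu≡ , _)     =
    inj₂ (short-single (α₁ , [] , trans ha≡ (cong (α₁ ++_) α₂≡)))
    where
    α₂≡ : α₂ ≡ (u ++ u) ++ []
    α₂≡ = sym (trans (++-identityʳ (u ++ u)) (trans uu≡ (++-identityʳ α₂)))
  ...   | inj₁ (δ₀ ∷ δ , uu≡ , fw₂≡) with w₂
  ...     | []     = case fw₂≡ of λ ()
  ...     | b ∷ w₃ = square-across w₁ a b w₃ {α₁} {α₂} {δ₀ ∷ δ} {β} {u} sf ha≡ uu≡ fw₂≡

lemma1 : (n : ℕ) → n ≥ 3 → (h : Fin n → List Σ₂)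
    → ((v : List (Fin n)) → length v ≡ 3 → SquareFree v → FS (morph h v))
    → (p : List Σ₂) → length p ≥ 3
    → ((a : Fin n) → Prefix p (h a))
    → ((as : List (Fin n)) (q r : List Σ₂) → morph h as ≡ q ++ p ++ r
        → (q ≡ []) ⊎ Σ ℕ (λ j → (j ≤ length as) × (q ≡ morph h (take j as))))
    → FSMorphism h
lemma1 n n≥3 h fs-triples p p-long p-prefix sync w w-sf u u≢[] (α , β , fw≡) =
  case square-short-or-contains-p w {α} {β} w-sf u≢[] fw≡ of λ where
    (inj₁ p⊑u) → ⊥-elim (no-square-containing-p w {α} {β} w-sf fw≡ p⊑u)
    (inj₂ (v , |v|≡3 , v-sf , uu⊑fv)) → fs-triples v |v|≡3 v-sf u u≢[] uu⊑fv
  where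
  -- n ≥ 3 is used only through n ≥ 2: a second letter pads short factors to length 3.
  open Synchronizing h fs-triples p p-long p-prefix sync (distinct-letter (≤-trans (n≤1+n 2) n≥3))
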